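{- Formulas of propositional dependence logic $\mathrm{DEP}$ and propositional inquisitive logic $\mathrm{INQ}$ are downward closed (and hence convex). Formulas of $\mathrm{CONDEP}$, $\mathrm{CONINQ}$ and $\mathrm{PL}_{\to}(\Diamond_e)$ are convex.
   Context: Propositional team semantics: teams are sets of valuations. Clauses: $t\vDash p$ iff $v(p)=1$ for all $v\in t$; $t\vDash\bot$ iff $t=\emptyset$; $t\vDash\neg\alpha$ ($\alpha$ classical) iff $\{v\}\nvDash\alpha$ for all $v\in t$; $\wedge$ as usual; $t\vDash\phi\vee\psi$ iff $t=s\cup u$ with $s\vDash\phi,u\vDash\psi$; $t\vDash\phi\,\dot\vee\,\psi$ iff $t\subseteq s\cup u$ with $s\vDash\phi,u\vDash\psi$; $t\vDash\phi\to\psi$ iff every $s\subseteq t$ with $s\vDash\phi$ has $s\vDash\psi$; dependence atom ${=}(p_1,\dots,p_n,p)$ true iff any two valuations in $t$ agreeing on all $p_i$ agree on $p$; $t\vDash\Diamond_e\phi$ ("epistemic might") iff some nonempty $s\subseteq t$ satisfies $\phi$; $t\vDash\phi\vee_g\psi$ (global disjunction) iff $t\vDash\phi$ or $t\vDash\psi$; $t\vDash\phi\,\dot\vee_g\,\psi$ iff some $s\supseteq t$ satisfies $\phi$ or $\psi$. Logics: $\mathrm{DEP}$: $p,\bot,\wedge,\vee,\neg\alpha$ ($\alpha$ classical over $\vee$), dependence atoms; $\mathrm{INQ}$: $p,\bot,\wedge,\to,\vee_g$; $\mathrm{CONDEP}$: $p,\bot,\wedge,\dot\vee,\neg\beta$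 ($\beta$ classical over $\dot\vee$), dependence atoms, $\Diamond_e$; $\mathrm{CONINQ}$: $p,\bot,\wedge,\to,\dot\vee_g,\Diamond_e$; $\mathrm{PL}_{\to}(\Diamond_e)$: $p,\bot,\wedge,\to,\Diamond_e$. A formula is downward closed if $t\vDash\phi$, $s\subseteq t$ imply $s\vDash\phi$; convex if $s\vDash\phi$, $t\vDash\phi$, $s\subseteq u\subseteq t$ imply $u\vDash\phi$. -}

module Defs where

open import Level using (Level; Lift; lift; 0ℓ) renaming (suc to lsuc)
open import Data.Nat using (ℕ)
open import Data.Bool using (Bool; true)
open import Data.List using (List)
open import Data.List.Relation.Unary.All using (All)
open import Data.Product using (Σ; ∃; _×_; _,_)
open import Data.Sum using (_⊎_)
open import Data.Empty using (⊥)
open import Relation.Nullary using (¬_)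
open import Relation.Binary.PropositionalEquality using (_≡_)

Var : Set
Var = ℕ

Valuation : Set
Valuation = Var → Bool

Team : Set₁
Team = Valuation → Set

_⊆_ : Team → Team → Set
s ⊆ t = ∀ v → s v → t v

_≐_∪_ : Team → Team → Team → Set
t ≐ s ∪ u = ∀ v → (t v → s v ⊎ u v) × (s v ⊎ u v → t v)

_⊆_∪_ : Team → Team → Team → Set
t ⊆ s ∪ u = ∀ v → t v → s v ⊎ u v

IsEmpty : Team → Set
IsEmpty t = ∀ v → ¬ t v

NonEmpty : Team → Set
NonEmpty t = ∃ λ v → t v

singleton : Valuation → Team
singleton v = λ w → w ≡ v

data Form : Set where
  atom   : Var → Form
  falsum : Form
  neg    : Form → Form                -- ¬α (only applied to classical α in the fragments)
  _∧'_   : Form → Form → Form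
  _∨'_   : Form → Form → Form
  _∨̇_    : Form → Form → Form
  _⇒_    : Form → Form → Form
  dep    : List Var → Var → Form
  might  : Form → Form
  _∨g_   : Form → Form → Form
  _∨̇g_   : Form → Form → Form

_⊨_ : Team → Form → Set₁
t ⊨ atom p    = Lift (lsuc 0ℓ) (∀ v → t v → v p ≡ true)
t ⊨ falsum    = Lift (lsuc 0ℓ) (IsEmpty t)
t ⊨ neg α     = ∀ v → t v → ¬ (singleton v ⊨ α)
t ⊨ (φ ∧' ψ)  = (t ⊨ φ) × (t ⊨ ψ)
t ⊨ (φ ∨' ψ)  = Σ Team λ s → Σ Team λ u → Lift (lsuc 0ℓ) (t ≐ s ∪ u) × (s ⊨ φ) × (u ⊨ ψ)
t ⊨ (φ ∨̇ ψ)   = Σ Team λ s → Σ Team λ u → Lift (lsuc 0ℓ) (t ⊆ s ∪ u) × (s ⊨ φ) × (u ⊨ ψ)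
t ⊨ (φ ⇒ ψ)   = ∀ (s : Team) → s ⊆ t → s ⊨ φ → s ⊨ ψ
t ⊨ dep ps p  = Lift (lsuc 0ℓ) (∀ v w → t v → t w → All (λ q → v q ≡ w q) ps → v p ≡ w p)
t ⊨ might φ   = Σ Team λ s → Lift (lsuc 0ℓ) (s ⊆ t × NonEmpty s) × (s ⊨ φ)
t ⊨ (φ ∨g ψ)  = (t ⊨ φ) ⊎ (t ⊨ ψ)
t ⊨ (φ ∨̇g ψ)  = Σ Team λ s → Lift (lsuc 0ℓ) (t ⊆ s) × ((s ⊨ φ) ⊎ (s ⊨ ψ))

data ClassicalDEP : Form → Set where
  c-atom : ∀ p → ClassicalDEP (atom p)
  c-bot  : ClassicalDEP falsum
  c-neg  : ∀ {α} → ClassicalDEP α → ClassicalDEP (neg α)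
  c-and  : ∀ {α β} → ClassicalDEP α → ClassicalDEP β → ClassicalDEP (α ∧' β)
  c-or   : ∀ {α β} → ClassicalDEP α → ClassicalDEP β → ClassicalDEP (α ∨' β)

data ClassicalCONDEP : Form → Set where
  c-atom : ∀ p → ClassicalCONDEP (atom p)
  c-bot  : ClassicalCONDEP falsum
  c-neg  : ∀ {α} → ClassicalCONDEP α → ClassicalCONDEP (neg α)
  c-and  : ∀ {α β} → ClassicalCONDEP α → ClassicalCONDEP β → ClassicalCONDEP (α ∧' β)
  c-or   : ∀ {α β} → ClassicalCONDEP α → ClassicalCONDEP β → ClassicalCONDEP (α ∨̇ β)

data DEP : Form → Set where
  d-atom : ∀ p → DEP (atom p)
  d-bot  : DEP falsum
  d-and  : ∀ {φ ψ} → DEP φ → DEP ψ → DEP (φ ∧' ψ)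
  d-or   : ∀ {φ ψ} → DEP φ → DEP ψ → DEP (φ ∨' ψ)
  d-neg  : ∀ {α} → ClassicalDEP α → DEP (neg α)
  d-dep  : ∀ ps p → DEP (dep ps p)

data INQ : Form → Set where
  i-atom : ∀ p → INQ (atom p)
  i-bot  : INQ falsum
  i-and  : ∀ {φ ψ} → INQ φ → INQ ψ → INQ (φ ∧' ψ)
  i-imp  : ∀ {φ ψ} → INQ φ → INQ ψ → INQ (φ ⇒ ψ)
  i-or   : ∀ {φ ψ} → INQ φ → INQ ψ → INQ (φ ∨g ψ)

data CONDEP : Form → Set where
  cd-atom  : ∀ p → CONDEP (atom p)
  cd-bot   : CONDEP falsum
  cd-and   : ∀ {φ ψ} → CONDEP φ → CONDEP ψ → CONDEP (φ ∧' ψ)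
  cd-or    : ∀ {φ ψ} → CONDEP φ → CONDEP ψ → CONDEP (φ ∨̇ ψ)
  cd-neg   : ∀ {β} → ClassicalCONDEP β → CONDEP (neg β)
  cd-dep   : ∀ ps p → CONDEP (dep ps p)
  cd-might : ∀ {φ} → CONDEP φ → CONDEP (might φ)

data CONINQ : Form → Set where
  ci-atom  : ∀ p → CONINQ (atom p)
  ci-bot   : CONINQ falsum
  ci-and   : ∀ {φ ψ} → CONINQ φ → CONINQ ψ → CONINQ (φ ∧' ψ)
  ci-imp   : ∀ {φ ψ} → CONINQ φ → CONINQ ψ → CONINQ (φ ⇒ ψ)
  ci-or    : ∀ {φ ψ} → CONINQ φ → CONINQ ψ → CONINQ (φ ∨̇g ψ)
  ci-might : ∀ {φ} → CONINQ φ → CONINQ (might φ)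

data PLimpMight : Form → Set where
  pm-atom  : ∀ p → PLimpMight (atom p)
  pm-bot   : PLimpMight falsum
  pm-and   : ∀ {φ ψ} → PLimpMight φ → PLimpMight ψ → PLimpMight (φ ∧' ψ)
  pm-imp   : ∀ {φ ψ} → PLimpMight φ → PLimpMight ψ → PLimpMight (φ ⇒ ψ)
  pm-might : ∀ {φ} → PLimpMight φ → PLimpMight (might φ)

DownwardClosed : Form → Set₁
DownwardClosed φ = ∀ (t s : Team) → t ⊨ φ → s ⊆ t → s ⊨ φ

Convex : Form → Set₁
Convex φ = ∀ (s u t : Team) → s ⊨ φ → t ⊨ φ → s ⊆ u → u ⊆ t → u ⊨ φ

-- Atoms, ⊥, negations and dependence atoms are downward closed, ∧ and the
-- split disjunction ∨ preserve downward closure (restrict each half of the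
-- split to the smaller team), and ∨g preserves it trivially; this gives DEP
-- and INQ. The formulas φ ⇒ ψ, φ ∨̇ ψ and φ ∨̇g ψ are downward closed whatever
-- φ and ψ are, ◇ₑ φ is upward closed, and ∧ preserves convexity; since
-- downward and upward closure each imply convexity, CONDEP, CONINQ and
-- PL→(◇ₑ) are convex.
module Submission where

open import Defs
open import Level using (lift)
open import Data.Product using (_×_; _,_; proj₁; proj₂)
open import Data.Sum using ([_,_]; inj₁; inj₂) renaming (map to map⊎)

UpwardClosed : Form → Set₁
UpwardClosed φ = ∀ (s t : Team) → s ⊨ φ → s ⊆ t → t ⊨ φ

⊆-trans : ∀ {r s t : Team} → r ⊆ s → s ⊆ t → r ⊆ t
⊆-trans r⊆s s⊆t v rv = s⊆t v (r⊆s v rv)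

_∩_ : Team → Team → Team
(s ∩ a) v = s v × a v

≐∪-restrict : ∀ {t a b s : Team} → t ≐ a ∪ b → s ⊆ t → s ≐ (s ∩ a) ∪ (s ∩ b)
≐∪-restrict t≐a∪b s⊆t v =
  (λ sv → map⊎ (sv ,_) (sv ,_) (proj₁ (t≐a∪b v) (s⊆t v sv))) , [ proj₁ , proj₁ ]

downwardClosed⇒convex : ∀ φ → DownwardClosed φ → Convex φ
downwardClosed⇒convex φ dc s u t _ ⊨t _ u⊆t = dc t u ⊨t u⊆t

upwardClosed⇒convex : ∀ φ → UpwardClosed φ → Convex φ
upwardClosed⇒convex φ uc s u t ⊨s _ s⊆u _ = uc s u ⊨s s⊆u

atom-downwardClosed : ∀ p → DownwardClosed (atom p)
atom-downwardClosed p t s (lift true-on-t) s⊆t = lift λ v sv → true-on-t v (s⊆t v sv)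

falsum-downwardClosed : DownwardClosed falsum
falsum-downwardClosed t s (lift t-empty) s⊆t = lift λ v sv → t-empty v (s⊆t v sv)

neg-downwardClosed : ∀ α → DownwardClosed (neg α)
neg-downwardClosed α t s ⊨t s⊆t v sv = ⊨t v (s⊆t v sv)

dep-downwardClosed : ∀ ps p → DownwardClosed (dep ps p)
dep-downwardClosed ps p t s (lift ⊨t) s⊆t =
  lift λ v w sv sw → ⊨t v w (s⊆t v sv) (s⊆t w sw)

∧-downwardClosed : ∀ {φ ψ} → DownwardClosed φ → DownwardClosed ψ → DownwardClosed (φ ∧' ψ)
∧-downwardClosed dcφ dcψ t s (⊨φ , ⊨ψ) s⊆t = dcφ t s ⊨φ s⊆t , dcψ t s ⊨ψ s⊆t

∨-downwardClosed : ∀ {φ ψ} → DownwardClosed φ → DownwardClosed ψ → DownwardClosed (φ ∨' ψ)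
∨-downwardClosed dcφ dcψ t s (a , b , lift t≐a∪b , a⊨φ , b⊨ψ) s⊆t =
  s ∩ a , s ∩ b , lift (≐∪-restrict t≐a∪b s⊆t) ,
  dcφ a (s ∩ a) a⊨φ (λ _ → proj₂) , dcψ b (s ∩ b) b⊨ψ (λ _ → proj₂)

∨g-downwardClosed : ∀ {φ ψ} → DownwardClosed φ → DownwardClosed ψ → DownwardClosed (φ ∨g ψ)
∨g-downwardClosed dcφ dcψ t s (inj₁ ⊨φ) s⊆t = inj₁ (dcφ t s ⊨φ s⊆t)
∨g-downwardClosed dcφ dcψ t s (inj₂ ⊨ψ) s⊆t = inj₂ (dcψ t s ⊨ψ s⊆t)

⇒-downwardClosed : ∀ φ ψ → DownwardClosed (φ ⇒ ψ)
⇒-downwardClosed φ ψ t s ⊨t s⊆t r r⊆s = ⊨t r (⊆-trans r⊆s s⊆t)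

∨̇-downwardClosed : ∀ φ ψ → DownwardClosed (φ ∨̇ ψ)
∨̇-downwardClosed φ ψ t s (a , b , lift t⊆a∪b , a⊨φ , b⊨ψ) s⊆t =
  a , b , lift (⊆-trans s⊆t t⊆a∪b) , a⊨φ , b⊨ψ

∨̇g-downwardClosed : ∀ φ ψ → DownwardClosed (φ ∨̇g ψ)
∨̇g-downwardClosed φ ψ t s (r , lift t⊆r , r⊨) s⊆t = r , lift (⊆-trans s⊆t t⊆r) , r⊨

might-upwardClosed : ∀ φ → UpwardClosed (might φ)
might-upwardClosed φ s t (r , lift (r⊆s , r-nonempty) , r⊨φ) s⊆t =
  r , lift (⊆-trans r⊆s s⊆t , r-nonempty) , r⊨φ

∧-convex : ∀ {φ ψ} → Convex φ → Convex ψ → Convex (φ ∧' ψ)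
∧-convex cvφ cvψ s u t (s⊨φ , s⊨ψ) (t⊨φ , t⊨ψ) s⊆u u⊆t =
  cvφ s u t s⊨φ t⊨φ s⊆u u⊆t , cvψ s u t s⊨ψ t⊨ψ s⊆u u⊆t

DEP-downwardClosed : ∀ φ → DEP φ → DownwardClosed φ
DEP-downwardClosed _ (d-atom p)    = atom-downwardClosed p
DEP-downwardClosed _ d-bot         = falsum-downwardClosed
DEP-downwardClosed _ (d-and φ ψ)   = ∧-downwardClosed (DEP-downwardClosed _ φ) (DEP-downwardClosed _ ψ)
DEP-downwardClosed _ (d-or φ ψ)    = ∨-downwardClosed (DEP-downwardClosed _ φ) (DEP-downwardClosed _ ψ)
DEP-downwardClosed _ (d-neg {α} _) = neg-downwardClosed α
DEP-downwardClosed _ (d-dep ps p)  = dep-downwardClosed ps p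

INQ-downwardClosed : ∀ φ → INQ φ → DownwardClosed φ
INQ-downwardClosed _ (i-atom p)          = atom-downwardClosed p
INQ-downwardClosed _ i-bot               = falsum-downwardClosed
INQ-downwardClosed _ (i-and φ ψ)         = ∧-downwardClosed (INQ-downwardClosed _ φ) (INQ-downwardClosed _ ψ)
INQ-downwardClosed _ (i-imp {φ} {ψ} _ _) = ⇒-downwardClosed φ ψ
INQ-downwardClosed _ (i-or φ ψ)          = ∨g-downwardClosed (INQ-downwardClosed _ φ) (INQ-downwardClosed _ ψ)

CONDEP-convex : ∀ φ → CONDEP φ → Convex φ
CONDEP-convex _ (cd-atom p)         = downwardClosed⇒convex (atom p) (atom-downwardClosed p)
CONDEP-convex _ cd-bot              = downwardClosed⇒convex falsum falsum-downwardClosed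
CONDEP-convex _ (cd-and φ ψ)        = ∧-convex (CONDEP-convex _ φ) (CONDEP-convex _ ψ)
CONDEP-convex _ (cd-or {φ} {ψ} _ _) = downwardClosed⇒convex (φ ∨̇ ψ) (∨̇-downwardClosed φ ψ)
CONDEP-convex _ (cd-neg {β} _)      = downwardClosed⇒convex (neg β) (neg-downwardClosed β)
CONDEP-convex _ (cd-dep ps p)       = downwardClosed⇒convex (dep ps p) (dep-downwardClosed ps p)
CONDEP-convex _ (cd-might {φ} _)    = upwardClosed⇒convex (might φ) (might-upwardClosed φ)

CONINQ-convex : ∀ φ → CONINQ φ → Convex φ
CONINQ-convex _ (ci-atom p)          = downwardClosed⇒convex (atom p) (atom-downwardClosed p)
CONINQ-convex _ ci-bot               = downwardClosed⇒convex falsum falsum-downwardClosed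
CONINQ-convex _ (ci-and φ ψ)         = ∧-convex (CONINQ-convex _ φ) (CONINQ-convex _ ψ)
CONINQ-convex _ (ci-imp {φ} {ψ} _ _) = downwardClosed⇒convex (φ ⇒ ψ) (⇒-downwardClosed φ ψ)
CONINQ-convex _ (ci-or {φ} {ψ} _ _)  = downwardClosed⇒convex (φ ∨̇g ψ) (∨̇g-downwardClosed φ ψ)
CONINQ-convex _ (ci-might {φ} _)     = upwardClosed⇒convex (might φ) (might-upwardClosed φ)

PLimpMight-convex : ∀ φ → PLimpMight φ → Convex φ
PLimpMight-convex _ (pm-atom p)          = downwardClosed⇒convex (atom p) (atom-downwardClosed p)
PLimpMight-convex _ pm-bot               = downwardClosed⇒convex falsum falsum-downwardClosed
PLimpMight-convex _ (pm-and φ ψ)         = ∧-convex (PLimpMight-convex _ φ) (PLimpMight-convex _ ψ)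
PLimpMight-convex _ (pm-imp {φ} {ψ} _ _) = downwardClosed⇒convex (φ ⇒ ψ) (⇒-downwardClosed φ ψ)
PLimpMight-convex _ (pm-might {φ} _)     = upwardClosed⇒convex (might φ) (might-upwardClosed φ)

proposition2p6 : ((φ : Form) → DEP φ → DownwardClosed φ × Convex φ)
               × ((φ : Form) → INQ φ → DownwardClosed φ × Convex φ)
               × ((φ : Form) → CONDEP φ → Convex φ)
               × ((φ : Form) → CONINQ φ → Convex φ)
               × ((φ : Form) → PLimpMight φ → Convex φ)
proposition2p6 =
  (λ φ φ∈DEP → DEP-downwardClosed φ φ∈DEP , downwardClosed⇒convex φ (DEP-downwardClosed φ φ∈DEP)) ,
  (λ φ φ∈INQ → INQ-downwardClosed φ φ∈INQ , downwardClosed⇒convex φ (INQ-downwardClosed φ φ∈INQ)) ,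
  CONDEP-convex , CONINQ-convex , PLimpMight-convex
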